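{- Let $\mathcal{L}$ be a finite set of distinct positive integers, exactly $c$ of which are even. Then $f_{\mathcal{L}}(n)=O(n^c)$ as $n\to\infty$.
   Context: For a set $\mathcal{L}$ of positive integers, $f_{\mathcal{L}}(n)$ denotes the maximum number of vectors in $\{0,1\}^n$ such that the Hamming distance between any two distinct ones lies in $\mathcal{L}$. The Hamming distance between two vectors is the number of coordinates in which they differ. -}

module Defs where

open import Data.Bool using (Bool; true; false; _≟_)
open import Data.Nat using (ℕ; zero; suc; _≤_; _*_; _^_)
open import Data.Nat.Divisibility using (_∣?_)
open import Data.Vec using (Vec; []; _∷_)
open import Data.List using (List; length; filter)
open import Data.List.Membership.Propositional using (_∈_)
open import Data.List.Relation.Unary.Unique.Propositional using (Unique)
open import Data.List.Relation.Unary.All using (All)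
open import Relation.Binary.PropositionalEquality using (_≡_; _≢_)
open import Relation.Nullary using (yes; no)
open import Data.Product using (_×_)

hamming : ∀ {n} → Vec Bool n → Vec Bool n → ℕ
hamming [] [] = zero
hamming (a ∷ xs) (b ∷ ys) with a ≟ b
... | yes _ = hamming xs ys
... | no  _ = suc (hamming xs ys)

DistanceSet : List ℕ → Set
DistanceSet L = Unique L × All (λ k → 1 ≤ k) L

numEven : List ℕ → ℕ
numEven L = length (filter (2 ∣?_) L)

LFamily : List ℕ → (n : ℕ) → List (Vec Bool n) → Set
LFamily L n A =
  Unique A ×
  (∀ x y → x ∈ A → y ∈ A → x ≢ y → hamming x y ∈ L)

{-# OPTIONS --safe #-}
-- Fix a member x of the family. For y, z at distance w from x,
--   d(y, z) + 2 j(x, y, z) = d(x, y) + d(x, z) = 2w,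
-- where j counts the coordinates in which x differs from both y and z, so the
-- family splits into at most max L + 1 spheres around x, each carrying a family
-- whose distances are among the c even elements of L. A sphere family of radius
-- w with at most s distances has O(n^s) members, by induction on w. If every
-- allowed distance is below 2w, then by the identity any member y shares with a
-- fixed member z a coordinate where both differ from x, so the w coordinates
-- where z differs from x index classes covering the family. Otherwise two
-- members differing from x in a common coordinate are at distance below 2w, so
-- the n classes indexed by all coordinates use fewer distances. Either way,
-- deleting the class coordinate leaves a sphere family of radius w - 1.

module Submission where

open import Defs
open import Data.Nat using (ℕ; _≤_; _*_; _^_)
open import Data.Bool using (Bool)
open import Data.Vec using (Vec)
open import Data.List using (List; length)
open import Data.Product using (Σ; _×_)

open import Data.Bool using (true; false) renaming (_≟_ to _≟ᵇ_)
open import Data.Bool.Properties using (¬-not)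
open import Data.Fin using (Fin; zero; suc)
open import Data.List using ([]; _∷_; map; filter; upTo; allFin)
open import Data.List.Extrema.Nat using (max; xs≤max)
open import Data.List.Membership.Propositional using (_∈_)
open import Data.List.Membership.Propositional.Properties
  using (∈-map⁺; ∈-map⁻; ∈-filter⁺; ∈-filter⁻; ∈-allFin; ∈-upTo⁺; ∈-upTo⁻)
open import Data.List.Properties using (length-map; length-upTo; length-tabulate; filter-notAll)
open import Data.List.Relation.Binary.Sublist.Propositional.Properties
  using (filter-⊆; filter⁺; length-mono-≤)
open import Data.List.Relation.Unary.All as All using (All; []; _∷_; all?)
open import Data.List.Relation.Unary.All.Properties as AllProperties using (¬All⇒Any¬)
open import Data.List.Relation.Unary.Any using (here; there)
open import Data.List.Relation.Unary.Unique.Propositional using (Unique; []; _∷_)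
import Data.List.Relation.Unary.Unique.Propositional.Properties as UniqueProperties
open import Data.Nat
  using (zero; suc; pred; _+_; _<_; _≤′_; ≤′-refl; ≤′-step; z≤n; s≤s; _≟_; _<?_)
open import Data.Nat.Divisibility using (_∣_; _∣?_; m∣m*n; ∣m+n∣m⇒∣n)
open import Data.Nat.Properties
open import Algebra.Properties.CommutativeSemigroup *-commutativeSemigroup using (x∙yz≈y∙xz)
open import Data.Nat.Tactic.RingSolver using (solve-∀)
open import Data.Product using (∃-syntax; _,_; proj₁; proj₂)
import Data.Product as Product
open import Data.Sum using (_⊎_; inj₁; inj₂)
open import Data.Vec using ([]; _∷_; lookup; removeAt; insertAt)
open import Data.Vec.Properties using (insertAt-removeAt; ≡-dec)
open import Function using (id)
open import Level using (0ℓ)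
open import Relation.Binary.PropositionalEquality
open import Relation.Nullary using (yes; no; ¬?; contradiction)
open import Relation.Unary using (Pred; Decidable)
open import Relation.Unary.Properties using (∁?)

private
  variable
    n w s K : ℕ

length-filter+filter-∁ : ∀ {A : Set} {Q : Pred A 0ℓ} (Q? : Decidable Q) xs →
  length (filter Q? xs) + length (filter (∁? Q?) xs) ≡ length xs
length-filter+filter-∁ Q? []       = refl
length-filter+filter-∁ Q? (x ∷ xs) with Q? x
... | yes _ = cong suc (length-filter+filter-∁ Q? xs)
... | no  _ = trans (+-suc _ _) (cong suc (length-filter+filter-∁ Q? xs))

union-bound : ∀ {I A : Set} {P : I → Pred A 0ℓ} (P? : ∀ i → Decidable (P i))
  (is : List I) {xs : List A} →
  (∀ {x} → x ∈ xs → ∃[ i ] i ∈ is × P i x) →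
  (∀ {i} → i ∈ is → length (filter (P? i) xs) ≤ K) →
  length xs ≤ length is * K
union-bound P? []       {[]}    _     _ = z≤n
union-bound P? []       {_ ∷ _} cover _ with () ← proj₁ (proj₂ (cover (here refl)))
union-bound {K = K} {P = P} P? (i ∷ is) {xs} cover bound = begin
  length xs                                  ≡⟨ length-filter+filter-∁ (P? i) xs ⟨
  length (filter (P? i) xs) + length others  ≤⟨ +-mono-≤ (bound (here refl))
                                                          (union-bound P? is cover′ bound′) ⟩
  K + length is * K                          ∎
  where
  open ≤-Reasoning
  others = filter (∁? (P? i)) xs
  cover′ : ∀ {x} → x ∈ others → ∃[ j ] j ∈ is × P j x
  cover′ x∈others with ∈-filter⁻ (∁? (P? i)) x∈others
  ... | x∈xs , ¬Pix with cover x∈xs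
  ...   | _ , here refl  , Pix = contradiction Pix ¬Pix
  ...   | j , there j∈is , Pjx = j , j∈is , Pjx
  bound′ : ∀ {j} → j ∈ is → length (filter (P? j) others) ≤ K
  bound′ {j} j∈is = ≤-trans
    (length-mono-≤ (filter⁺ (P? j) (P? j) (λ { refl → id }) (filter-⊆ (∁? (P? i)) xs)))
    (bound (there j∈is))

unique-map-injectiveOn : ∀ {A B : Set} {f : A → B} {xs : List A} →
  (∀ {x y} → x ∈ xs → y ∈ xs → f x ≡ f y → x ≡ y) → Unique xs → Unique (map f xs)
unique-map-injectiveOn {xs = []}     _   []           = []
unique-map-injectiveOn {xs = x ∷ xs} inj (x∉xs ∷ uxs) =
  AllProperties.map⁺ (All.tabulate λ y∈xs fx≡fy →
    All.lookup x∉xs y∈xs (inj (here refl) (there y∈xs) fx≡fy))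
  ∷ unique-map-injectiveOn (λ y∈ z∈ → inj (there y∈) (there z∈)) uxs

unique-constant-length≤1 : ∀ {A : Set} {x : A} {xs} →
  Unique xs → (∀ {y} → y ∈ xs → y ≡ x) → length xs ≤ 1
unique-constant-length≤1 {xs = []}        _               _  = z≤n
unique-constant-length≤1 {xs = _ ∷ []}    _               _  = s≤s z≤n
unique-constant-length≤1 {xs = _ ∷ _ ∷ _} ((y≢z ∷ _) ∷ _) ≡x =
  contradiction (trans (≡x (here refl)) (sym (≡x (there (here refl))))) y≢z

^-distrib-* : ∀ a b c → (a * b) ^ c ≡ a ^ c * b ^ c
^-distrib-* a b zero    = refl
^-distrib-* a b (suc c) = begin
  a * b * (a * b) ^ c      ≡⟨ cong (a * b *_) (^-distrib-* a b c) ⟩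
  a * b * (a ^ c * b ^ c)  ≡⟨ interchange a b (a ^ c) (b ^ c) ⟩
  a * a ^ c * (b * b ^ c)  ∎
  where
  open ≡-Reasoning
  interchange : ∀ i j k l → i * j * (k * l) ≡ i * k * (j * l)
  interchange = solve-∀

[1+n]^c≤2^c*n^c : ∀ n c → 1 ≤ n → suc n ^ c ≤ 2 ^ c * n ^ c
[1+n]^c≤2^c*n^c n c 1≤n = begin
  suc n ^ c      ≤⟨ ^-monoˡ-≤ c 1+n≤2*n ⟩
  (2 * n) ^ c    ≡⟨ ^-distrib-* 2 n c ⟩
  2 ^ c * n ^ c  ∎
  where
  open ≤-Reasoning
  1+n≤2*n : suc n ≤ 2 * n
  1+n≤2*n = ≤-trans (+-monoˡ-≤ n 1≤n) (≤-reflexive (cong (n +_) (sym (+-identityʳ n))))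

-- Hamming distance coordinate by coordinate

_≢[_]_ : Vec Bool n → Fin n → Vec Bool n → Set
x ≢[ e ] y = lookup x e ≢ lookup y e

differs? : (x : Vec Bool n) (e : Fin n) → Decidable (x ≢[ e ]_)
differs? x e y = ¬? (lookup x e ≟ᵇ lookup y e)

mismatch : Bool → Bool → ℕ
mismatch true  false = 1
mismatch false true  = 1
mismatch _     _     = 0

mismatch-self : ∀ a → mismatch a a ≡ 0
mismatch-self true  = refl
mismatch-self false = refl

mismatch-≢ : ∀ {a b} → a ≢ b → mismatch a b ≡ 1
mismatch-≢ {true}  {true}  a≢b = contradiction refl a≢b
mismatch-≢ {true}  {false} _   = refl
mismatch-≢ {false} {true}  _   = refl
mismatch-≢ {false} {false} a≢b = contradiction refl a≢b

hamming-∷ : ∀ a b (x y : Vec Bool n) → hamming (a ∷ x) (b ∷ y) ≡ mismatch a b + hamming x y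
hamming-∷ true  true  x y = refl
hamming-∷ true  false x y = refl
hamming-∷ false true  x y = refl
hamming-∷ false false x y = refl

hamming-self : (x : Vec Bool n) → hamming x x ≡ 0
hamming-self []          = refl
hamming-self (true ∷ x)  = hamming-self x
hamming-self (false ∷ x) = hamming-self x

hamming≡0⇒≡ : (x y : Vec Bool n) → hamming x y ≡ 0 → x ≡ y
hamming≡0⇒≡ []          []          _ = refl
hamming≡0⇒≡ (true ∷ x)  (true ∷ y)  h = cong (true ∷_) (hamming≡0⇒≡ x y h)
hamming≡0⇒≡ (false ∷ x) (false ∷ y) h = cong (false ∷_) (hamming≡0⇒≡ x y h)

hamming-removeAt : (x y : Vec Bool (suc n)) (e : Fin (suc n)) →
  hamming x y ≡ mismatch (lookup x e) (lookup y e) + hamming (removeAt x e) (removeAt y e)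
hamming-removeAt (a ∷ x) (b ∷ y) zero = hamming-∷ a b x y
hamming-removeAt (a ∷ x@(_ ∷ _)) (b ∷ y@(_ ∷ _)) (suc e) = begin
  hamming (a ∷ x) (b ∷ y)                           ≡⟨ hamming-∷ a b x y ⟩
  mismatch a b + hamming x y                        ≡⟨ cong (mismatch a b +_) (hamming-removeAt x y e) ⟩
  mismatch a b + (mismatchₑ + hamming x′ y′)        ≡⟨ +-exchange (mismatch a b) mismatchₑ _ ⟩
  mismatchₑ + (mismatch a b + hamming x′ y′)        ≡⟨ cong (mismatchₑ +_) (hamming-∷ a b x′ y′) ⟨
  mismatchₑ + hamming (a ∷ x′) (b ∷ y′)             ∎
  where
  open ≡-Reasoning
  x′ = removeAt x e
  y′ = removeAt y e
  mismatchₑ = mismatch (lookup x e) (lookup y e)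
  +-exchange : ∀ i j k → i + (j + k) ≡ j + (i + k)
  +-exchange = solve-∀

hamming-removeAt-agree : (x y : Vec Bool (suc n)) (e : Fin (suc n)) →
  lookup x e ≡ lookup y e → hamming x y ≡ hamming (removeAt x e) (removeAt y e)
hamming-removeAt-agree x y e xₑ≡yₑ = begin
  hamming x y                                    ≡⟨ hamming-removeAt x y e ⟩
  mismatch (lookup x e) (lookup y e) + hamming′  ≡⟨ cong (λ a → mismatch a (lookup y e) + hamming′) xₑ≡yₑ ⟩
  mismatch (lookup y e) (lookup y e) + hamming′  ≡⟨ cong (_+ hamming′) (mismatch-self (lookup y e)) ⟩
  hamming′                                       ∎
  where
  open ≡-Reasoning
  hamming′ = hamming (removeAt x e) (removeAt y e)

hamming-removeAt-differ : (x y : Vec Bool (suc n)) (e : Fin (suc n)) → x ≢[ e ] y →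
  hamming x y ≡ suc (hamming (removeAt x e) (removeAt y e))
hamming-removeAt-differ x y e x≢y = trans (hamming-removeAt x y e)
  (cong (_+ hamming (removeAt x e) (removeAt y e)) (mismatch-≢ x≢y))

removeAt-injective : (x y : Vec Bool (suc n)) (e : Fin (suc n)) →
  lookup x e ≡ lookup y e → removeAt x e ≡ removeAt y e → x ≡ y
removeAt-injective x y e xₑ≡yₑ x′≡y′ = begin
  x                                       ≡⟨ insertAt-removeAt x e ⟨
  insertAt (removeAt x e) e (lookup x e)  ≡⟨ cong₂ (λ v a → insertAt v e a) x′≡y′ xₑ≡yₑ ⟩
  insertAt (removeAt y e) e (lookup y e)  ≡⟨ insertAt-removeAt y e ⟩
  y                                       ∎
  where open ≡-Reasoning

mismatches : Vec Bool n → Vec Bool n → List (Fin n)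
mismatches []      []      = []
mismatches (a ∷ x) (b ∷ y) with a ≟ᵇ b
... | yes _ = map suc (mismatches x y)
... | no  _ = zero ∷ map suc (mismatches x y)

length-mismatches : (x y : Vec Bool n) → length (mismatches x y) ≡ hamming x y
length-mismatches []      []      = refl
length-mismatches (a ∷ x) (b ∷ y) with a ≟ᵇ b
... | yes _ = trans (length-map suc (mismatches x y)) (length-mismatches x y)
... | no  _ = cong suc (trans (length-map suc (mismatches x y)) (length-mismatches x y))

differ⇒∈-mismatches : (x y : Vec Bool n) (e : Fin n) → x ≢[ e ] y → e ∈ mismatches x y
differ⇒∈-mismatches (a ∷ x) (b ∷ y) zero a≢b with a ≟ᵇ b
... | yes a≡b = contradiction a≡b a≢b
... | no  _   = here refl
differ⇒∈-mismatches (a ∷ x) (b ∷ y) (suc e) x≢y with a ≟ᵇ b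
... | yes _ = ∈-map⁺ suc (differ⇒∈-mismatches x y e x≢y)
... | no  _ = there (∈-map⁺ suc (differ⇒∈-mismatches x y e x≢y))

-- Three vectors

jointDifference : Vec Bool n → Vec Bool n → Vec Bool n → ℕ
jointDifference []      []      []      = 0
jointDifference (a ∷ x) (b ∷ y) (c ∷ z) = mismatch a b * mismatch a c + jointDifference x y z

mismatch-+-jointDifference : ∀ a b c →
  mismatch b c + 2 * (mismatch a b * mismatch a c) ≡ mismatch a b + mismatch a c
mismatch-+-jointDifference true  true  true  = refl
mismatch-+-jointDifference true  true  false = refl
mismatch-+-jointDifference true  false true  = refl
mismatch-+-jointDifference true  false false = refl
mismatch-+-jointDifference false true  true  = refl
mismatch-+-jointDifference false true  false = refl
mismatch-+-jointDifference false false true  = refl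
mismatch-+-jointDifference false false false = refl

hamming-+-jointDifference : (x y z : Vec Bool n) →
  hamming y z + 2 * jointDifference x y z ≡ hamming x y + hamming x z
hamming-+-jointDifference [] [] [] = refl
hamming-+-jointDifference (a ∷ x) (b ∷ y) (c ∷ z) = begin
  hamming (b ∷ y) (c ∷ z) + 2 * jointDifference (a ∷ x) (b ∷ y) (c ∷ z)
    ≡⟨ cong (_+ 2 * (jₐ + j)) (hamming-∷ b c y z) ⟩
  mismatch b c + hamming y z + 2 * (jₐ + j)
    ≡⟨ regroup (mismatch b c) (hamming y z) jₐ j ⟩
  (mismatch b c + 2 * jₐ) + (hamming y z + 2 * j)
    ≡⟨ cong₂ _+_ (mismatch-+-jointDifference a b c) (hamming-+-jointDifference x y z) ⟩
  (mismatch a b + mismatch a c) + (hamming x y + hamming x z)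
    ≡⟨ interchange (mismatch a b) (mismatch a c) (hamming x y) (hamming x z) ⟩
  (mismatch a b + hamming x y) + (mismatch a c + hamming x z)
    ≡⟨ cong₂ _+_ (hamming-∷ a b x y) (hamming-∷ a c x z) ⟨
  hamming (a ∷ x) (b ∷ y) + hamming (a ∷ x) (c ∷ z)
    ∎
  where
  open ≡-Reasoning
  jₐ = mismatch a b * mismatch a c
  j  = jointDifference x y z
  regroup : ∀ i h k l → i + h + 2 * (k + l) ≡ (i + 2 * k) + (h + 2 * l)
  regroup = solve-∀
  interchange : ∀ i h k l → (i + h) + (k + l) ≡ (i + k) + (h + l)
  interchange = solve-∀

jointDifference>0⇒shared-difference : (x y z : Vec Bool n) → 0 < jointDifference x y z →
  ∃[ e ] x ≢[ e ] y × x ≢[ e ] z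
jointDifference>0⇒shared-difference [] [] [] ()
jointDifference>0⇒shared-difference (true ∷ _) (false ∷ _) (false ∷ _) _ = zero , (λ ()) , (λ ())
jointDifference>0⇒shared-difference (false ∷ _) (true ∷ _) (true ∷ _) _ = zero , (λ ()) , (λ ())
jointDifference>0⇒shared-difference (true ∷ x) (true ∷ y) (_ ∷ z) p =
  Product.map suc id (jointDifference>0⇒shared-difference x y z p)
jointDifference>0⇒shared-difference (false ∷ x) (false ∷ y) (_ ∷ z) p =
  Product.map suc id (jointDifference>0⇒shared-difference x y z p)
jointDifference>0⇒shared-difference (true ∷ x) (false ∷ y) (true ∷ z) p =
  Product.map suc id (jointDifference>0⇒shared-difference x y z p)
jointDifference>0⇒shared-difference (false ∷ x) (true ∷ y) (false ∷ z) p =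
  Product.map suc id (jointDifference>0⇒shared-difference x y z p)

shared-difference⇒jointDifference>0 : (x y z : Vec Bool n) (e : Fin n) →
  x ≢[ e ] y → x ≢[ e ] z → 0 < jointDifference x y z
shared-difference⇒jointDifference>0 (true ∷ _)  (false ∷ _) (false ∷ _) zero _ _ = s≤s z≤n
shared-difference⇒jointDifference>0 (false ∷ _) (true ∷ _)  (true ∷ _)  zero _ _ = s≤s z≤n
shared-difference⇒jointDifference>0 (true ∷ _)  (true ∷ _)  _ zero a≢b _ = contradiction refl a≢b
shared-difference⇒jointDifference>0 (false ∷ _) (false ∷ _) _ zero a≢b _ = contradiction refl a≢b
shared-difference⇒jointDifference>0 (true ∷ _)  _ (true ∷ _)  zero _ a≢c = contradiction refl a≢c
shared-difference⇒jointDifference>0 (false ∷ _) _ (false ∷ _) zero _ a≢c = contradiction refl a≢c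
shared-difference⇒jointDifference>0 (a ∷ x) (b ∷ y) (c ∷ z) (suc e) x≢y x≢z =
  ≤-trans (shared-difference⇒jointDifference>0 x y z e x≢y x≢z)
          (m≤n+m _ (mismatch a b * mismatch a c))

strict-triangle⇒shared-difference : (x y z : Vec Bool n) →
  hamming y z < hamming x y + hamming x z → ∃[ e ] x ≢[ e ] y × x ≢[ e ] z
strict-triangle⇒shared-difference x y z d<d+d = jointDifference>0⇒shared-difference x y z
  (n≢0⇒n>0 λ j≡0 → <⇒≢ d<d+d (begin
    hamming y z                              ≡⟨ +-identityʳ (hamming y z) ⟨
    hamming y z + 2 * 0                      ≡⟨ cong (λ j → hamming y z + 2 * j) j≡0 ⟨
    hamming y z + 2 * jointDifference x y z  ≡⟨ hamming-+-jointDifference x y z ⟩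
    hamming x y + hamming x z                ∎))
  where open ≡-Reasoning

shared-difference⇒strict-triangle : (x y z : Vec Bool n) (e : Fin n) →
  x ≢[ e ] y → x ≢[ e ] z → hamming y z < hamming x y + hamming x z
shared-difference⇒strict-triangle x y z e x≢y x≢z = begin-strict
  hamming y z                <⟨ m<m+n (hamming y z) (≤-trans j>0 (m≤m+n j (j + 0))) ⟩
  hamming y z + 2 * j        ≡⟨ hamming-+-jointDifference x y z ⟩
  hamming x y + hamming x z  ∎
  where
  open ≤-Reasoning
  j = jointDifference x y z
  j>0 = shared-difference⇒jointDifference>0 x y z e x≢y x≢z

hamming>0⇒difference : (x y : Vec Bool n) → 0 < hamming x y → ∃[ e ] x ≢[ e ] y
hamming>0⇒difference x y d>0 = Product.map₂ proj₁ (strict-triangle⇒shared-difference x y y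
  (subst (_< hamming x y + hamming x y) (sym (hamming-self y)) (≤-trans d>0 (m≤m+n _ _))))

hamming-sphere-even : (x y z : Vec Bool n) → hamming x y ≡ w → hamming x z ≡ w → 2 ∣ hamming y z
hamming-sphere-even {w = w} x y z xy≡w xz≡w =
  ∣m+n∣m⇒∣n (subst (2 ∣_) (sym 2j+d≡2w) (m∣m*n w)) (m∣m*n (jointDifference x y z))
  where
  open ≡-Reasoning
  2j+d≡2w : 2 * jointDifference x y z + hamming y z ≡ 2 * w
  2j+d≡2w = begin
    2 * jointDifference x y z + hamming y z  ≡⟨ +-comm _ (hamming y z) ⟩
    hamming y z + 2 * jointDifference x y z  ≡⟨ hamming-+-jointDifference x y z ⟩
    hamming x y + hamming x z                ≡⟨ cong₂ _+_ xy≡w xz≡w ⟩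
    w + w                                    ≡⟨ cong (w +_) (+-identityʳ w) ⟨
    2 * w                                    ∎

-- Families on a sphere

OnSphere : Vec Bool n → ℕ → List (Vec Bool n) → Set
OnSphere x w A = ∀ {y} → y ∈ A → hamming x y ≡ w

LFamily-distance : ∀ {D A} → LFamily D n A →
  ∀ {y z} → y ∈ A → z ∈ A → hamming y z ≡ 0 ⊎ hamming y z ∈ D
LFamily-distance (_ , dist) {y} {z} y∈A z∈A with ≡-dec _≟ᵇ_ y z
... | yes refl = inj₁ (hamming-self y)
... | no  y≢z  = inj₂ (dist y z y∈A z∈A y≢z)

LFamily-filter : ∀ {D A} {P : Pred (Vec Bool n) 0ℓ} (P? : Decidable P) → Unique A →
  (∀ {y z} → y ∈ A → z ∈ A → P y → P z → y ≢ z → hamming y z ∈ D) →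
  LFamily D n (filter P? A)
LFamily-filter P? uA dist = UniqueProperties.filter⁺ P? uA , λ y z y∈ z∈ y≢z →
  let (y∈A , Py) = ∈-filter⁻ P? y∈
      (z∈A , Pz) = ∈-filter⁻ P? z∈
  in dist y∈A z∈A Py Pz y≢z

OnSphere-filter : ∀ {x : Vec Bool n} {A} {P : Pred (Vec Bool n) 0ℓ} (P? : Decidable P) →
  OnSphere x w A → OnSphere x w (filter P? A)
OnSphere-filter P? sph y∈ = sph (proj₁ (∈-filter⁻ P? y∈))

module _ (x : Vec Bool (suc n)) (e : Fin (suc n)) {F : List (Vec Bool (suc n))}
         (differ : ∀ {y} → y ∈ F → x ≢[ e ] y) where

  private
    agree : ∀ {y z} → y ∈ F → z ∈ F → lookup y e ≡ lookup z e
    agree y∈F z∈F = trans (¬-not (≢-sym (differ y∈F))) (sym (¬-not (≢-sym (differ z∈F))))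

    removeₑ : Vec Bool (suc n) → Vec Bool n
    removeₑ y = removeAt y e

  LFamily-removeAt : ∀ {D} → LFamily D (suc n) F → LFamily D n (map removeₑ F)
  LFamily-removeAt {D} (uF , dist) =
    unique-map-injectiveOn (λ {y} {z} y∈F z∈F → removeAt-injective y z e (agree y∈F z∈F)) uF
    , dist′
    where
    dist′ : ∀ y′ z′ → y′ ∈ map removeₑ F → z′ ∈ map removeₑ F → y′ ≢ z′ → hamming y′ z′ ∈ D
    dist′ _ _ y′∈ z′∈ y′≢z′ with ∈-map⁻ removeₑ y′∈ | ∈-map⁻ removeₑ z′∈
    ... | y , y∈F , refl | z , z∈F , refl =
      subst (_∈ D) (hamming-removeAt-agree y z e (agree y∈F z∈F))
        (dist y z y∈F z∈F λ { refl → y′≢z′ refl })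

  OnSphere-removeAt : OnSphere x (suc w) F → OnSphere (removeAt x e) w (map removeₑ F)
  OnSphere-removeAt sph y′∈ with ∈-map⁻ removeₑ y′∈
  ... | y , y∈F , refl =
    suc-injective (trans (sym (hamming-removeAt-differ x y e (differ y∈F))) (sph y∈F))

SphereBound : ℕ → ℕ → ℕ → ℕ → Set
SphereBound n w s K =
  (x : Vec Bool n) {D : List ℕ} {A : List (Vec Bool n)} →
  length D ≤ s → LFamily D n A → OnSphere x w A → length A ≤ K

differsAt-class-bound : SphereBound n w s K →
  (x : Vec Bool (suc n)) (e : Fin (suc n)) {D : List ℕ} {A : List (Vec Bool (suc n))} →
  length D ≤ s → Unique A → OnSphere x (suc w) A →
  (∀ {y z} → y ∈ A → z ∈ A → x ≢[ e ] y → x ≢[ e ] z → y ≢ z → hamming y z ∈ D) →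
  length (filter (differs? x e) A) ≤ K
differsAt-class-bound {n} {w} {K = K} bound x e {D} {A} ∣D∣≤s uA sph dist =
  subst (_≤ K) (length-map (λ y → removeAt y e) F)
    (bound (removeAt x e) ∣D∣≤s (LFamily-removeAt x e differ famF) (OnSphere-removeAt x e differ sphF))
  where
  F = filter (differs? x e) A
  differ : ∀ {y} → y ∈ F → x ≢[ e ] y
  differ y∈F = proj₂ (∈-filter⁻ (differs? x e) {xs = A} y∈F)
  famF : LFamily D (suc n) F
  famF = LFamily-filter (differs? x e) uA dist
  sphF : OnSphere x (suc w) F
  sphF = OnSphere-filter {x = x} (differs? x e) sph

shrinking-bound : SphereBound n w s K →
  (x : Vec Bool (suc n)) {D : List ℕ} {A : List (Vec Bool (suc n))} →
  length (filter (_<? suc w + suc w) D) ≤ s → LFamily D (suc n) A → OnSphere x (suc w) A →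
  length A ≤ suc n * K
shrinking-bound {n} {w} {K = K} bound x {D} {A} ∣D′∣≤s (uA , dist) sph = begin
  length A                     ≤⟨ union-bound (differs? x) (allFin (suc n)) {A} cover class ⟩
  length (allFin (suc n)) * K  ≡⟨ cong (_* K) (length-tabulate {n = suc n} id) ⟩
  suc n * K                    ∎
  where
  open ≤-Reasoning
  cover : ∀ {y} → y ∈ A → ∃[ e ] e ∈ allFin (suc n) × x ≢[ e ] y
  cover {y} y∈A =
    let (e , x≢y) = hamming>0⇒difference x y (subst (0 <_) (sym (sph y∈A)) (s≤s z≤n))
    in e , ∈-allFin e , x≢y
  class : ∀ {e} → e ∈ allFin (suc n) → length (filter (differs? x e) A) ≤ K
  class {e} _ = differsAt-class-bound bound x e ∣D′∣≤s uA sph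
    λ {y} {z} y∈A z∈A x≢y x≢z y≢z →
      ∈-filter⁺ (_<? suc w + suc w) (dist y z y∈A z∈A y≢z)
        (subst (hamming y z <_) (cong₂ _+_ (sph y∈A) (sph z∈A))
          (shared-difference⇒strict-triangle x y z e x≢y x≢z))

short-distances-bound : SphereBound n w s K →
  (x : Vec Bool (suc n)) {D : List ℕ} {A : List (Vec Bool (suc n))} →
  All (_< suc w + suc w) D → length D ≤ s → LFamily D (suc n) A → OnSphere x (suc w) A →
  length A ≤ suc w * K
short-distances-bound bound x {A = []} _ _ _ _ = z≤n
short-distances-bound {w = w} {K = K} bound x {D} {A = z ∷ rest} short ∣D∣≤s fam sph = begin
  length (z ∷ rest)            ≤⟨ union-bound (differs? x) (mismatches x z) {z ∷ rest} cover class ⟩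
  length (mismatches x z) * K  ≡⟨ cong (_* K) (trans (length-mismatches x z) (sph (here refl))) ⟩
  suc w * K                    ∎
  where
  open ≤-Reasoning
  close : ∀ {y} → y ∈ z ∷ rest → hamming y z < suc w + suc w
  close {y} y∈A with LFamily-distance fam y∈A (here refl)
  ... | inj₁ d≡0 = subst (_< suc w + suc w) (sym d≡0) (s≤s z≤n)
  ... | inj₂ d∈D = All.lookup short d∈D
  cover : ∀ {y} → y ∈ z ∷ rest → ∃[ e ] e ∈ mismatches x z × x ≢[ e ] y
  cover {y} y∈A =
    let (e , x≢y , x≢z) = strict-triangle⇒shared-difference x y z
          (subst (hamming y z <_) (sym (cong₂ _+_ (sph y∈A) (sph (here refl)))) (close y∈A))
    in e , differ⇒∈-mismatches x z e x≢z , x≢y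
  class : ∀ {e} → e ∈ mismatches x z → length (filter (differs? x e) (z ∷ rest)) ≤ K
  class {e} _ = differsAt-class-bound bound x e ∣D∣≤s (proj₁ fam) sph
    λ y∈A z∈A _ _ y≢z → proj₂ fam _ _ y∈A z∈A y≢z

-- The summands account for the two cases of the induction step: short-distances-bound
-- and shrinking-bound.
sphereCoeff : ℕ → ℕ → ℕ
sphereCoeff zero    s = 1
sphereCoeff (suc w) s = suc w * sphereCoeff w s + sphereCoeff w (pred s)

sphereCoeff-short : ∀ w s n →
  suc w * (sphereCoeff w s * suc n ^ s) ≤ sphereCoeff (suc w) s * suc (suc n) ^ s
sphereCoeff-short w s n = begin
  suc w * (sphereCoeff w s * suc n ^ s)    ≡⟨ *-assoc (suc w) (sphereCoeff w s) _ ⟨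
  suc w * sphereCoeff w s * suc n ^ s      ≤⟨ *-mono-≤ (m≤m+n (suc w * sphereCoeff w s) _)
                                                       (^-monoˡ-≤ s (n≤1+n (suc n))) ⟩
  sphereCoeff (suc w) s * suc (suc n) ^ s  ∎
  where open ≤-Reasoning

sphereCoeff-shrinking : ∀ w s n →
  suc n * (sphereCoeff w s * suc n ^ s) ≤ sphereCoeff (suc w) (suc s) * suc (suc n) ^ suc s
sphereCoeff-shrinking w s n = begin
  suc n * (sphereCoeff w s * suc n ^ s)              ≡⟨ x∙yz≈y∙xz (suc n) (sphereCoeff w s) _ ⟩
  sphereCoeff w s * suc n ^ suc s                    ≤⟨ *-mono-≤ (m≤n+m (sphereCoeff w s) (suc w * sphereCoeff w (suc s)))
                                                                 (^-monoˡ-≤ (suc s) (n≤1+n (suc n))) ⟩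
  sphereCoeff (suc w) (suc s) * suc (suc n) ^ suc s  ∎
  where open ≤-Reasoning

sphereCoeff-≤-suc : ∀ w s → sphereCoeff w s ≤ sphereCoeff (suc w) s
sphereCoeff-≤-suc w s =
  ≤-trans (m≤m+n (sphereCoeff w s) _) (m≤m+n (suc w * sphereCoeff w s) (sphereCoeff w (pred s)))

sphereCoeff-mono : ∀ {v w} s → v ≤ w → sphereCoeff v s ≤ sphereCoeff w s
sphereCoeff-mono s v≤w = go (≤⇒≤′ v≤w)
  where
  go : ∀ {v w} → v ≤′ w → sphereCoeff v s ≤ sphereCoeff w s
  go ≤′-refl              = ≤-refl
  go (≤′-step {w} v≤′w) = ≤-trans (go v≤′w) (sphereCoeff-≤-suc w s)

sphere-bound : ∀ w s → SphereBound n w s (sphereCoeff w s * suc n ^ s)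
sphere-bound {n} zero s x _ (uA , _) sph =
  ≤-trans (unique-constant-length≤1 uA λ y∈A → sym (hamming≡0⇒≡ x _ (sph y∈A)))
          (≤-trans (m^n>0 (suc n) s) (m≤m+n _ 0))
sphere-bound {zero} (suc w) s [] {A = []}     _ _ _   = z≤n
sphere-bound {zero} (suc w) s [] {A = [] ∷ _} _ _ sph with () ← sph (here refl)
sphere-bound {suc n} (suc w) s x {D} {A} ∣D∣≤s fam sph with all? (_<? suc w + suc w) D
... | yes short = ≤-trans (short-distances-bound (sphere-bound w s) x short ∣D∣≤s fam sph)
                          (sphereCoeff-short w s n)
... | no ¬short = shrinking s (<-≤-trans (filter-notAll short? D (¬All⇒Any¬ short? D ¬short)) ∣D∣≤s)
  where
  short? = _<? suc w + suc w
  shrinking : ∀ s → length (filter short? D) < s → length A ≤ sphereCoeff (suc w) s * suc (suc n) ^ s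
  shrinking (suc s) (s≤s ∣D′∣≤s) =
    ≤-trans (shrinking-bound (sphere-bound w s) x ∣D′∣≤s fam sph) (sphereCoeff-shrinking w s n)

LFamily-onSphere-bound : ∀ {L} (x : Vec Bool n) {A} → LFamily L n A → OnSphere x w A →
  length A ≤ sphereCoeff w (numEven L) * suc n ^ numEven L
LFamily-onSphere-bound {w = w} {L} x (uA , dist) sph =
  sphere-bound w (numEven L) x ≤-refl (uA , evenDist) sph
  where
  evenDist : ∀ y z → y ∈ _ → z ∈ _ → y ≢ z → hamming y z ∈ filter (2 ∣?_) L
  evenDist y z y∈A z∈A y≢z =
    ∈-filter⁺ (2 ∣?_) (dist y z y∈A z∈A y≢z) (hamming-sphere-even x y z (sph y∈A) (sph z∈A))

LFamily-ball-bound : ∀ {L M} (x : Vec Bool n) {A} → LFamily L n A →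
  (∀ {y} → y ∈ A → hamming x y ≤ M) →
  length A ≤ suc M * (sphereCoeff M (numEven L) * suc n ^ numEven L)
LFamily-ball-bound {n} {L} {M} x {A} (uA , dist) inBall = begin
  length A                          ≤⟨ union-bound onSphere? (upTo (suc M)) {A} cover layer ⟩
  length (upTo (suc M)) * perLayer  ≡⟨ cong (_* perLayer) (length-upTo (suc M)) ⟩
  suc M * perLayer                  ∎
  where
  open ≤-Reasoning
  c = numEven L
  perLayer = sphereCoeff M c * suc n ^ c
  onSphere? : ∀ w → Decidable (λ y → hamming x y ≡ w)
  onSphere? w y = hamming x y ≟ w
  cover : ∀ {y} → y ∈ A → ∃[ w ] w ∈ upTo (suc M) × hamming x y ≡ w
  cover {y} y∈A = hamming x y , ∈-upTo⁺ (s≤s (inBall y∈A)) , refl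
  layer : ∀ {w} → w ∈ upTo (suc M) → length (filter (onSphere? w) A) ≤ perLayer
  layer {w} w∈ = ≤-trans
    (LFamily-onSphere-bound x
      (LFamily-filter (onSphere? w) uA λ y∈A z∈A _ _ y≢z → dist _ _ y∈A z∈A y≢z)
      (λ y∈ → proj₂ (∈-filter⁻ (onSphere? w) {xs = A} y∈)))
    (*-monoˡ-≤ (suc n ^ c) (sphereCoeff-mono c (≤-pred (∈-upTo⁻ w∈))))

theorem7 : (L : List ℕ) → DistanceSet L →
    Σ ℕ λ C → Σ ℕ λ N →
      (n : ℕ) → N ≤ n → (A : List (Vec Bool n)) → LFamily L n A →
        length A ≤ C * n ^ numEven L
theorem7 L _ = suc M * sphereCoeff M c * 2 ^ c , 1 , bound
  where
  c = numEven L
  M = max 0 L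
  bound : (n : ℕ) → 1 ≤ n → (A : List (Vec Bool n)) → LFamily L n A →
    length A ≤ suc M * sphereCoeff M c * 2 ^ c * n ^ c
  bound n _   []        _   = z≤n
  bound n 1≤n A@(x ∷ _) fam = begin
    length A                                     ≤⟨ LFamily-ball-bound x fam radius≤M ⟩
    suc M * (sphereCoeff M c * suc n ^ c)        ≤⟨ *-monoʳ-≤ (suc M) (*-monoʳ-≤ (sphereCoeff M c)
                                                      ([1+n]^c≤2^c*n^c n c 1≤n)) ⟩
    suc M * (sphereCoeff M c * (2 ^ c * n ^ c))  ≡⟨ reassociate (suc M) (sphereCoeff M c) (2 ^ c) (n ^ c) ⟩
    suc M * sphereCoeff M c * 2 ^ c * n ^ c      ∎
    where
    open ≤-Reasoning
    reassociate : ∀ i j k l → i * (j * (k * l)) ≡ i * j * k * l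
    reassociate = solve-∀
    radius≤M : ∀ {y} → y ∈ A → hamming x y ≤ M
    radius≤M y∈A with LFamily-distance fam (here refl) y∈A
    ... | inj₁ d≡0 = subst (_≤ M) (sym d≡0) z≤n
    ... | inj₂ d∈L = All.lookup (xs≤max 0 L) d∈L
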